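{- Let $E(X,Y)\equiv|X\triangle Y|<\omega$, where $X\triangle Y=(X\setminus Y)\cup(Y\setminus X)$. Then $A[E]$ (the Nuisance Principle) proves that $V$ is finite (i.e. $|V|<\omega$).
   Context: Many-sorted second-order logic (objects; $n$-ary relations, unary ones called concepts) with Henkin semantics. $A[E]$ is the theory in the signature with a function symbol $\partial$ from concepts to objects consisting of $\forall X,Y(\partial(X)=\partial(Y)\leftrightarrow E(X,Y))$, the full comprehension schema for all formulas, the choice schema AC: $[\forall\bar x\,\exists R'\,\varphi(R',\bar x)]\to\exists R\,\forall\bar x\,\varphi(R[\bar x],\bar x)$ with $R[\bar x]=\{\bar y:R\bar x\bar y\}$, and global choice GC: a binary relation symbol $<$ on objects, a linear order such that every formula (parameters allowed) satisfied by some object is satisfied by a $<$-least one. $V=\{x:x=x\}$; $|Z|<\omega$ means $Z$ is Dedekind-finite: every injection $Z\to Z$ (a binary relation of the model) is a surjection. -}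

module Defs where

-- Many-sorted second-order logic with Henkin semantics, deep-embedded syntax
-- (needed to state the comprehension / choice / global-choice SCHEMAS),
-- Henkin structures, satisfaction, and the theory A[E] for
-- E(X,Y) ≡ |X △ Y| < ω (Dedekind-finiteness inside the model).

open import Data.Nat using (ℕ; zero; suc; _+_)
open import Data.Nat.Properties using (+-suc)
open import Data.Vec using (Vec; []; _∷_; _++_; cast; map)
open import Data.List using (List; []; _∷_; replicate) renaming (_++_ to _++ᴸ_)
open import Data.Product using (Σ; _×_; _,_)
open import Data.Sum using (_⊎_)
open import Data.Empty using (⊥)
open import Data.Unit using (⊤)
open import Relation.Nullary using (¬_)
open import Relation.Binary.PropositionalEquality using (_≡_)

_⟷_ : Set → Set → Set
P ⟷ Q = (P → Q) × (Q → P)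

-- Sorts: objects, and relation variables.  `rel k` is the sort of
-- (suc k)-ary relations (arities are ≥ 1); concepts are `rel 0`.
data Sort : Set where
  obj : Sort
  rel : ℕ → Sort

Ctx : Set
Ctx = List Sort

data Var : Ctx → Sort → Set where
  here  : ∀ {Γ s} → Var (s ∷ Γ) s
  there : ∀ {Γ s t} → Var Γ s → Var (t ∷ Γ) s

objs : ℕ → Ctx
objs m = replicate m obj

data Term (Γ : Ctx) : Set where
  var : Var Γ obj → Term Γ
  ∂   : Var Γ (rel 0) → Term Γ

data Fm (Γ : Ctx) : Set where
  _≐_  : Term Γ → Term Γ → Fm Γ
  _≺_  : Term Γ → Term Γ → Fm Γ
  app  : ∀ {k} → Var Γ (rel k) → Vec (Term Γ) (suc k) → Fm Γ
  ⊥̇    : Fm Γ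
  _⇒_  : Fm Γ → Fm Γ → Fm Γ
  _∧̇_  : Fm Γ → Fm Γ → Fm Γ
  _∨̇_  : Fm Γ → Fm Γ → Fm Γ
  ∀̇    : (s : Sort) → Fm (s ∷ Γ) → Fm Γ
  ∃̇    : (s : Sort) → Fm (s ∷ Γ) → Fm Γ

-- Rel k is the domain of
-- (suc k)-ary relations, with membership `mem`; `ext` makes relations
-- extensional (each relation domain is a set of subsets of D^(k+1)).

record Structure : Set₁ where
  field
    D    : Set
    Rel  : ℕ → Set
    mem  : ∀ {k} → Rel k → Vec D (suc k) → Set
    ext  : ∀ {k} (R S : Rel k) → (∀ v → mem R v ⟷ mem S v) → R ≡ S
    del  : Rel 0 → D
    lt   : D → D → Set

module _ (M : Structure) where
  open Structure M

  Val : Sort → Set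
  Val obj     = D
  Val (rel k) = Rel k

  Env : Ctx → Set
  Env Γ = ∀ {s} → Var Γ s → Val s

  _∷ₑ_ : ∀ {Γ s} → Val s → Env Γ → Env (s ∷ Γ)
  (a ∷ₑ ρ) here      = a
  (a ∷ₑ ρ) (there x) = ρ x

  -- extend an environment by a tuple of objects (first component = newest variable)
  extVec : ∀ {Γ m} → Vec D m → Env Γ → Env (objs m ++ᴸ Γ)
  extVec []      ρ = ρ
  extVec (x ∷ v) ρ = x ∷ₑ extVec v ρ

  evalT : ∀ {Γ} → Term Γ → Env Γ → D
  evalT (var x) ρ = ρ x
  evalT (∂ X)   ρ = del (ρ X)

  Sat : ∀ {Γ} → Fm Γ → Env Γ → Set
  Sat (t ≐ u)   ρ = evalT t ρ ≡ evalT u ρ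
  Sat (t ≺ u)   ρ = lt (evalT t ρ) (evalT u ρ)
  Sat (app R ts) ρ = mem (ρ R) (map (λ t → evalT t ρ) ts)
  Sat ⊥̇         ρ = ⊥
  Sat (φ ⇒ ψ)   ρ = Sat φ ρ → Sat ψ ρ
  Sat (φ ∧̇ ψ)   ρ = Sat φ ρ × Sat ψ ρ
  Sat (φ ∨̇ ψ)   ρ = Sat φ ρ ⊎ Sat ψ ρ
  Sat (∀̇ s φ)   ρ = (a : Val s) → Sat φ (a ∷ₑ ρ)
  Sat (∃̇ s φ)   ρ = Σ (Val s) λ a → Sat φ (a ∷ₑ ρ)

  pair : D → D → Vec D 2
  pair x y = x ∷ y ∷ []

  IsInjectionOn : Rel 1 → (D → Set) → Set
  IsInjectionOn F Z =
      (∀ x → Z x → Σ D λ y → Z y × mem F (pair x y))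
    × (∀ x y y′ → Z x → mem F (pair x y) → mem F (pair x y′) → y ≡ y′)
    × (∀ x x′ y → Z x → Z x′ → mem F (pair x y) → mem F (pair x′ y) → x ≡ x′)

  IsSurjectionOn : Rel 1 → (D → Set) → Set
  IsSurjectionOn F Z = ∀ y → Z y → Σ D λ x → Z x × mem F (pair x y)

  DFinite : (D → Set) → Set
  DFinite Z = (F : Rel 1) → IsInjectionOn F Z → IsSurjectionOn F Z

  SymDiff : Rel 0 → Rel 0 → D → Set
  SymDiff X Y x = (mem X (x ∷ []) × ¬ mem Y (x ∷ []))
                ⊎ (mem Y (x ∷ []) × ¬ mem X (x ∷ []))

  E : Rel 0 → Rel 0 → Set
  E X Y = DFinite (SymDiff X Y)

  V : D → Set
  V x = x ≡ x

  AbstractionAxiom : Set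
  AbstractionAxiom = ∀ (X Y : Rel 0) → (del X ≡ del Y) ⟷ E X Y

  Comprehension : Set
  Comprehension = ∀ {Γ} (k : ℕ) (φ : Fm (objs (suc k) ++ᴸ Γ)) (ρ : Env Γ) →
    Σ (Rel k) λ R → ∀ (v : Vec D (suc k)) → mem R v ⟷ Sat φ (extVec v ρ)

  -- Choice schema: [∀x̄ ∃R' φ(R',x̄)] → ∃R ∀x̄ φ(R[x̄],x̄),
  -- x̄ of length m, R' of arity k+1, R of arity m+k+1; φ(R[x̄],x̄) is
  -- rendered as "the section R[x̄] (a relation of the model, coextensive
  -- with {ȳ : R x̄ ȳ}) satisfies φ".
  Choice : Set
  Choice = ∀ {Γ} (m k : ℕ) (φ : Fm (rel k ∷ (objs m ++ᴸ Γ))) (ρ : Env Γ) →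
    (∀ (v : Vec D m) → Σ (Rel k) λ R′ → Sat φ (R′ ∷ₑ extVec v ρ)) →
    Σ (Rel (m + k)) λ R → ∀ (v : Vec D m) →
      Σ (Rel k) λ S →
        (∀ (w : Vec D (suc k)) → mem S w ⟷ mem R (cast (+-suc m k) (v ++ w)))
        × Sat φ (S ∷ₑ extVec v ρ)

  GlobalChoice : Set
  GlobalChoice =
      (∀ x → ¬ lt x x)
    × (∀ x y z → lt x y → lt y z → lt x z)
    × (∀ x y → lt x y ⊎ x ≡ y ⊎ lt y x)
    × (∀ {Γ} (φ : Fm (obj ∷ Γ)) (ρ : Env Γ) →
         Σ D (λ d → Sat φ (d ∷ₑ ρ)) →
         Σ D λ d → Sat φ (d ∷ₑ ρ) × (∀ e → Sat φ (e ∷ₑ ρ) → d ≡ e ⊎ lt d e))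

  ModelOfA[E] : Set
  ModelOfA[E] = AbstractionAxiom × Comprehension × Choice × GlobalChoice

LEM : Set₁
LEM = (P : Set) → P ⊎ ¬ P

{-# OPTIONS --safe #-}
module Submission where

-- Suppose an injection F : V → V misses y₀. Pairing Fⁿ y₀ with F²ⁿ y₀ and fixing everything off
-- the F-orbit of y₀ gives an injection H : V → V whose range misses the Dedekind-infinite concept
-- Odds = {F²ⁿ⁺¹ y₀}. Choice gives a relation R with ∂ R[y] = y for every abstract y. As H is
-- injective, y ↦ ∂ H[R[y]] (the identity off the abstracts) is an injection T, and
-- k x = ∂ (H[R[x]] ∪ Odds) is injective on abstracts and never a value of T, because
-- H[R[a]] and H[R[x]] ∪ Odds differ on all of Odds. So the T-orbits of the k x are disjoint
-- and Dedekind-infinite. For Diag = {y : y ∈ Orb T (k x), y ∉ R[x] for some abstract x} and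
-- z = ∂ Diag, the concepts Diag and R[z] differ on the whole orbit of k z, although
-- ∂ Diag = z = ∂ R[z].

open import Data.Vec using (Vec; []; _∷_)
open import Data.List using ([]; _∷_)
open import Data.Product using (Σ; _×_; _,_; proj₁; proj₂)
open import Data.Sum using (_⊎_; inj₁; inj₂)
open import Data.Empty using (⊥; ⊥-elim)
open import Relation.Nullary using (¬_)
open import Relation.Binary.PropositionalEquality using (_≡_; _≢_; refl; sym; trans; cong; subst)

open import Defs hiding (_∷ₑ_)

pattern x0 = here
pattern x1 = there x0
pattern x2 = there x1
pattern x3 = there x2
pattern x4 = there x3
pattern x5 = there x4
pattern x6 = there x5
pattern x7 = there x6
pattern x8 = there x7
pattern x9 = there x8
pattern x10 = there x9

variable
  Γ : Ctx

infix 25 _∈̇_ _≐ᵛ_ _⟨_,_⟩̇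
infix 22 ¬̇_

_∈̇_ : Var Γ obj → Var Γ (rel 0) → Fm Γ
x ∈̇ X = app X (var x ∷ [])

_⟨_,_⟩̇ : Var Γ (rel 1) → Var Γ obj → Var Γ obj → Fm Γ
G ⟨ x , y ⟩̇ = app G (var x ∷ var y ∷ [])

_≐ᵛ_ : Var Γ obj → Var Γ obj → Fm Γ
x ≐ᵛ y = var x ≐ var y

¬̇_ : Fm Γ → Fm Γ
¬̇ φ = φ ⇒ ⊥̇

_⇔̇_ : Fm Γ → Fm Γ → Fm Γ
φ ⇔̇ ψ = (φ ⇒ ψ) ∧̇ (ψ ⇒ φ)

module Definable (lem : LEM) (M : Structure) (comp : Comprehension M) where
  open Structure M

  infix 25 _∈_
  _∈_ : D → Rel 0 → Set
  x ∈ X = mem X (x ∷ [])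

  _⟪_,_⟫ : Rel 1 → D → D → Set
  G ⟪ x , y ⟫ = mem G (x ∷ y ∷ [])

  infixr 5 _∷ₑ_
  _∷ₑ_ : ∀ {s} → Val M s → Env M Γ → Env M (s ∷ Γ)
  _∷ₑ_ = Defs._∷ₑ_ M

  []ₑ : Env M []
  []ₑ ()

  -- Formulas use de Bruijn indices: in concept φ ρ the element is x0, in relation φ ρ the pair
  -- ⟪ x , y ⟫ is (x0, x1), and ρ supplies the indices after these.
  concept : Fm (obj ∷ Γ) → Env M Γ → Rel 0
  concept φ ρ = proj₁ (comp 0 φ ρ)

  concept⁺ : ∀ {φ : Fm (obj ∷ Γ)} {ρ : Env M Γ} {x} → Sat M φ (x ∷ₑ ρ) → x ∈ concept φ ρ
  concept⁺ {φ = φ} {ρ} {x} = proj₂ (proj₂ (comp 0 φ ρ) (x ∷ []))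

  concept⁻ : ∀ {φ : Fm (obj ∷ Γ)} {ρ : Env M Γ} {x} → x ∈ concept φ ρ → Sat M φ (x ∷ₑ ρ)
  concept⁻ {φ = φ} {ρ} {x} = proj₁ (proj₂ (comp 0 φ ρ) (x ∷ []))

  relation : Fm (obj ∷ obj ∷ Γ) → Env M Γ → Rel 1
  relation φ ρ = proj₁ (comp 1 φ ρ)

  relation⁺ : ∀ {φ : Fm (obj ∷ obj ∷ Γ)} {ρ : Env M Γ} {x y} →
    Sat M φ (x ∷ₑ y ∷ₑ ρ) → relation φ ρ ⟪ x , y ⟫
  relation⁺ {φ = φ} {ρ} {x} {y} = proj₂ (proj₂ (comp 1 φ ρ) (x ∷ y ∷ []))

  relation⁻ : ∀ {φ : Fm (obj ∷ obj ∷ Γ)} {ρ : Env M Γ} {x y} →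
    relation φ ρ ⟪ x , y ⟫ → Sat M φ (x ∷ₑ y ∷ₑ ρ)
  relation⁻ {φ = φ} {ρ} {x} {y} = proj₁ (proj₂ (comp 1 φ ρ) (x ∷ y ∷ []))

  concept-ext : {X Y : Rel 0} → (∀ w → w ∈ X ⟷ w ∈ Y) → X ≡ Y
  concept-ext {X} {Y} e = ext X Y λ { (w ∷ []) → e w }

  section : Rel 1 → D → Rel 0
  section P x = concept (x2 ⟨ x1 , x0 ⟩̇) (x ∷ₑ P ∷ₑ []ₑ)

  ∂Graph : Rel 1 → Rel 1
  ∂Graph P = relation (∃̇ (rel 0) (∀̇ obj (x0 ∈̇ x1 ⇔̇ x4 ⟨ x2 , x0 ⟩̇) ∧̇ (∂ x0 ≐ var x2)))
                      (P ∷ₑ []ₑ)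

  ∂Graph⁺ : ∀ {P x t} → t ≡ del (section P x) → ∂Graph P ⟪ x , t ⟫
  ∂Graph⁺ {P} {x} t≡∂ = relation⁺ (section P x , (λ w → concept⁻ , concept⁺) , sym t≡∂)

  ∂Graph⁻ : ∀ {P x t} → ∂Graph P ⟪ x , t ⟫ → t ≡ del (section P x)
  ∂Graph⁻ ∂Pxt with relation⁻ ∂Pxt
  ... | Y , Y≈section , refl =
    cong del (concept-ext λ w → (λ p → concept⁺ (proj₁ (Y≈section w) p))
                              , (λ p → proj₂ (Y≈section w) (concept⁻ p)))

  ∅ : Rel 0
  ∅ = concept ⊥̇ []ₑ

  dom : Rel 1 → Rel 0
  dom G = concept (∃̇ obj (x2 ⟨ x1 , x0 ⟩̇)) (G ∷ₑ []ₑ)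

  Total Functional Injective : Rel 1 → Set
  Total G = ∀ x → Σ D λ y → G ⟪ x , y ⟫
  Functional G = ∀ x y y′ → G ⟪ x , y ⟫ → G ⟪ x , y′ ⟫ → y ≡ y′
  Injective G = ∀ x x′ y → G ⟪ x , y ⟫ → G ⟪ x′ , y ⟫ → x ≡ x′

  record IsInjection (G : Rel 1) : Set where
    field
      total      : Total G
      functional : Functional G
      injective  : Injective G

  Maps : Rel 1 → (D → Set) → (D → Set) → Set
  Maps G P Q = ∀ a b → P a → G ⟪ a , b ⟫ → Q b

  Closed : Rel 1 → Rel 0 → Set
  Closed G X = Maps G (_∈ X) (_∈ X)

  module _ {G : Rel 1} {P : D → Set} where

    IsInjectionOn⇒Maps : IsInjectionOn M G P → Maps G P P
    IsInjectionOn⇒Maps (total , functional , _) a b Pa Gab with total a Pa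
    ... | c , Pc , Gac = subst P (functional a c b Pa Gac Gab) Pc

    IsInjection⇒IsInjectionOn : IsInjection G → Maps G P P → IsInjectionOn M G P
    IsInjection⇒IsInjectionOn G-inj G-maps =
        (λ x Px → let (y , Gxy) = total x in y , G-maps x y Px Gxy , Gxy)
      , (λ x y y′ _ → functional x y y′)
      , (λ x x′ y _ _ → injective x x′ y)
      where open IsInjection G-inj

  IsInjectionOn-V⇒IsInjection : ∀ {G} → IsInjectionOn M G (V M) → IsInjection G
  IsInjectionOn-V⇒IsInjection (total , functional , injective) = record
    { total      = λ x → let (y , _ , Gxy) = total x refl in y , Gxy
    ; functional = λ x y y′ → functional x y y′ refl
    ; injective  = λ x x′ y → injective x x′ y refl refl
    }

  infixr 9 _∘ʳ_
  _∘ʳ_ : Rel 1 → Rel 1 → Rel 1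
  G ∘ʳ F = relation (∃̇ obj (x4 ⟨ x1 , x0 ⟩̇ ∧̇ x3 ⟨ x0 , x2 ⟩̇)) (G ∷ₑ F ∷ₑ []ₑ)

  ∘-injection : ∀ {F G} → IsInjection F → IsInjection G → IsInjection (G ∘ʳ F)
  ∘-injection {F} {G} F-inj G-inj =
    record { total = total ; functional = functional ; injective = injective }
    where
    module F = IsInjection F-inj
    module G = IsInjection G-inj

    total : Total (G ∘ʳ F)
    total a with F.total a
    ... | c , Fac with G.total c
    ... | b , Gcb = b , relation⁺ (c , Fac , Gcb)

    functional : Functional (G ∘ʳ F)
    functional a b b′ p q with relation⁻ p | relation⁻ q
    ... | c , Fac , Gcb | c′ , Fac′ , Gc′b′ with F.functional a c c′ Fac Fac′
    ... | refl = G.functional c b b′ Gcb Gc′b′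

    injective : Injective (G ∘ʳ F)
    injective a a′ b p q with relation⁻ p | relation⁻ q
    ... | c , Fac , Gcb | c′ , Fa′c′ , Gc′b with G.injective c c′ b Gcb Gc′b
    ... | refl = F.injective a a′ c Fac Fa′c′

  patch : Rel 0 → Rel 1 → Rel 1
  patch P G = relation ((x0 ∈̇ x2 ∧̇ x3 ⟨ x0 , x1 ⟩̇) ∨̇ (¬̇ x0 ∈̇ x2 ∧̇ x1 ≐ᵛ x0)) (P ∷ₑ G ∷ₑ []ₑ)

  patch-injection : ∀ {P G} → IsInjectionOn M G (_∈ P) → IsInjection (patch P G)
  patch-injection {P} {G} G-inj@(G-total , G-functional , G-injective) =
    record { total = total ; functional = functional ; injective = injective }
    where
    total : Total (patch P G)
    total a with lem (a ∈ P)
    ... | inj₁ aP = let (b , _ , Gab) = G-total a aP in b , relation⁺ (inj₁ (aP , Gab))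
    ... | inj₂ a∉P = a , relation⁺ (inj₂ (a∉P , refl))

    functional : Functional (patch P G)
    functional a b b′ p q with relation⁻ p | relation⁻ q
    ... | inj₁ (aP , Gab) | inj₁ (_ , Gab′) = G-functional a b b′ aP Gab Gab′
    ... | inj₁ (aP , _)   | inj₂ (a∉P , _)  = ⊥-elim (a∉P aP)
    ... | inj₂ (a∉P , _)  | inj₁ (aP , _)   = ⊥-elim (a∉P aP)
    ... | inj₂ (_ , b≡a)  | inj₂ (_ , b′≡a) = trans b≡a (sym b′≡a)

    injective : Injective (patch P G)
    injective a a′ b p q with relation⁻ p | relation⁻ q
    ... | inj₁ (aP , Gab) | inj₁ (a′P , Ga′b) = G-injective a a′ b aP a′P Gab Ga′b
    ... | inj₁ (aP , Gab) | inj₂ (a′∉P , refl) =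
      ⊥-elim (a′∉P (IsInjectionOn⇒Maps G-inj a b aP Gab))
    ... | inj₂ (a∉P , refl) | inj₁ (a′P , Ga′b) =
      ⊥-elim (a∉P (IsInjectionOn⇒Maps G-inj a′ b a′P Ga′b))
    ... | inj₂ (_ , b≡a) | inj₂ (_ , b≡a′) = trans (sym b≡a) b≡a′

  DInfinite : Rel 0 → Set
  DInfinite S = ¬ DFinite M (_∈ S)

  DFinite-resp : ∀ {P Q : D → Set} → (∀ x → P x ⟷ Q x) → DFinite M P → DFinite M Q
  DFinite-resp {P} {Q} P⟷Q P-fin f (total , functional , injective) y Qy
    with P-fin f (total′ , functional′ , injective′) y (Q⇒P Qy)
    where
    P⇒Q : ∀ {x} → P x → Q x
    P⇒Q = proj₁ (P⟷Q _)
    Q⇒P : ∀ {x} → Q x → P x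
    Q⇒P = proj₂ (P⟷Q _)
    total′ : ∀ x → P x → Σ D λ y → P y × f ⟪ x , y ⟫
    total′ x Px = let (y , Qy , fxy) = total x (P⇒Q Px) in y , Q⇒P Qy , fxy
    functional′ : ∀ x y y′ → P x → f ⟪ x , y ⟫ → f ⟪ x , y′ ⟫ → y ≡ y′
    functional′ x y y′ Px = functional x y y′ (P⇒Q Px)
    injective′ : ∀ x x′ y → P x → P x′ → f ⟪ x , y ⟫ → f ⟪ x′ , y ⟫ → x ≡ x′
    injective′ x x′ y Px Px′ = injective x x′ y (P⇒Q Px) (P⇒Q Px′)
  ... | x , Px , fxy = x , proj₁ (P⟷Q x) Px , fxy

  -- Conjugating by G carries an injection f of S that is not onto to an injection of P that is
  -- not onto: f′ is G ∘ f ∘ G⁻¹ on G[S] and the identity on the rest of P.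
  module Conjugation {G f : Rel 1} {S : Rel 0} {P : D → Set} (G-injection : IsInjection G)
    (G-maps : Maps G (_∈ S) P) (f-injection : IsInjectionOn M f (_∈ S)) where
    open IsInjection G-injection

    image : Rel 0
    image = concept (∃̇ obj (x0 ∈̇ x3 ∧̇ x2 ⟨ x0 , x1 ⟩̇)) (G ∷ₑ S ∷ₑ []ₑ)

    conjugate : Rel 1
    conjugate = relation (∃̇ obj (x3 ⟨ x0 , x1 ⟩̇ ∧̇ ∃̇ obj (x5 ⟨ x1 , x0 ⟩̇ ∧̇ x4 ⟨ x0 , x3 ⟩̇)))
                         (G ∷ₑ f ∷ₑ []ₑ)

    preimage-∈ : ∀ {a u} → u ∈ image → G ⟪ a , u ⟫ → a ∈ S
    preimage-∈ {a} {u} u∈image Gau with concept⁻ u∈image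
    ... | a₀ , a₀∈S , Ga₀u = subst (_∈ S) (injective a₀ a u Ga₀u Gau) a₀∈S

    conjugate-on-image : IsInjectionOn M conjugate (_∈ image)
    conjugate-on-image = total′ , functional′ , injective′
      where
      f-total = proj₁ f-injection
      f-functional = proj₁ (proj₂ f-injection)
      f-injective = proj₂ (proj₂ f-injection)

      total′ : ∀ u → u ∈ image → Σ D λ w → w ∈ image × conjugate ⟪ u , w ⟫
      total′ u u∈image with concept⁻ u∈image
      ... | a , a∈S , Gau with f-total a a∈S
      ... | b , b∈S , fab with total b
      ... | w , Gbw = w , concept⁺ (b , b∈S , Gbw) , relation⁺ (a , Gau , b , fab , Gbw)

      functional′ : ∀ u w w′ → u ∈ image → conjugate ⟪ u , w ⟫ → conjugate ⟪ u , w′ ⟫ → w ≡ w′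
      functional′ u w w′ u∈image c c′ with relation⁻ c | relation⁻ c′
      ... | a , Gau , b , fab , Gbw | a′ , Ga′u , b′ , fa′b′ , Gb′w′
        with injective a a′ u Gau Ga′u
      ... | refl with f-functional a b b′ (preimage-∈ u∈image Gau) fab fa′b′
      ... | refl = functional b w w′ Gbw Gb′w′

      injective′ : ∀ u u′ w → u ∈ image → u′ ∈ image →
        conjugate ⟪ u , w ⟫ → conjugate ⟪ u′ , w ⟫ → u ≡ u′
      injective′ u u′ w u∈image u′∈image c c′ with relation⁻ c | relation⁻ c′
      ... | a , Gau , b , fab , Gbw | a′ , Ga′u′ , b′ , fa′b′ , Gb′w
        with injective b b′ w Gbw Gb′w
      ... | refl with f-injective a a′ b (preimage-∈ u∈image Gau) (preimage-∈ u′∈image Ga′u′) fab fa′b′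
      ... | refl = functional a u u′ Gau Ga′u′

    f′ : Rel 1
    f′ = patch image conjugate

    f′-maps : Maps f′ P P
    f′-maps u w Pu f′uw with relation⁻ f′uw
    ... | inj₂ (_ , refl) = Pu
    ... | inj₁ (u∈image , c) with relation⁻ c
    ... | a , Gau , b , fab , Gbw =
      G-maps b w (IsInjectionOn⇒Maps f-injection a b (preimage-∈ u∈image Gau) fab) Gbw

    f′-on-P : IsInjectionOn M f′ P
    f′-on-P = IsInjection⇒IsInjectionOn (patch-injection conjugate-on-image) f′-maps

    f′-surjective⇒f-surjective : IsSurjectionOn M f′ P → IsSurjectionOn M f (_∈ S)
    f′-surjective⇒f-surjective f′-surjective y y∈S with total y
    ... | u , Gyu with f′-surjective u (G-maps y u y∈S Gyu)
    ... | t , _ , f′tu with relation⁻ f′tu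
    ... | inj₂ (t∉image , refl) = ⊥-elim (t∉image (concept⁺ (y , y∈S , Gyu)))
    ... | inj₁ (t∈image , c) with relation⁻ c
    ... | a , Gat , b , fab , Gbu with injective b y u Gbu Gyu
    ... | refl = a , preimage-∈ t∈image Gat , fab

  DFinite-embedding : ∀ {G S P} → IsInjection G → Maps G (_∈ S) P →
    DFinite M P → DFinite M (_∈ S)
  DFinite-embedding G-injection G-maps P-finite f f-injection =
    f′-surjective⇒f-surjective (P-finite f′ f′-on-P)
    where open Conjugation G-injection G-maps f-injection

  identity : Rel 1
  identity = relation (x0 ≐ᵛ x1) []ₑ

  identity-injection : IsInjection identity
  identity-injection = record
    { total      = λ x → x , relation⁺ refl
    ; functional = λ x y y′ p q → trans (sym (relation⁻ p)) (relation⁻ q)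
    ; injective  = λ x x′ y p q → trans (relation⁻ p) (sym (relation⁻ q))
    }

  DInfinite-subset : ∀ {S P} → DInfinite S → (∀ a → a ∈ S → P a) → ¬ DFinite M P
  DInfinite-subset S-infinite S⊆P P-finite =
    S-infinite (DFinite-embedding identity-injection
      (λ a b a∈S a≡b → subst _ (relation⁻ a≡b) (S⊆P a a∈S)) P-finite)

  SD : Rel 0 → Rel 0 → Rel 0
  SD X Y = concept ((x0 ∈̇ x1 ∧̇ ¬̇ x0 ∈̇ x2) ∨̇ (x0 ∈̇ x2 ∧̇ ¬̇ x0 ∈̇ x1)) (X ∷ₑ Y ∷ₑ []ₑ)

  E-pullback : ∀ {G X Y X′ Y′} → IsInjection G →
    (∀ a b → SymDiff M X′ Y′ a → G ⟪ a , b ⟫ → SymDiff M X Y b) → E M X Y → E M X′ Y′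
  E-pullback {X′ = X′} {Y′} G-injection G-maps XY-finite =
    DFinite-resp (λ _ → concept⁻ , concept⁺)
      (DFinite-embedding {S = SD X′ Y′} G-injection (λ a b a∈SD → G-maps a b (concept⁻ a∈SD))
        XY-finite)

  Orbits : Rel 1 → Rel 1
  Orbits T = relation
    (∀̇ (rel 0) ((x1 ∈̇ x0 ∧̇ ∀̇ obj (∀̇ obj (x1 ∈̇ x2 ⇒ (x5 ⟨ x1 , x0 ⟩̇ ⇒ x0 ∈̇ x2)))) ⇒ x2 ∈̇ x0))
    (T ∷ₑ []ₑ)

  Orb : Rel 1 → D → Rel 0
  Orb T r = section (Orbits T) r

  module _ {T : Rel 1} {r : D} where

    Orb-root : r ∈ Orb T r
    Orb-root = concept⁺ (relation⁺ λ X (r∈X , _) → r∈X)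

    Orb-closed : Closed T (Orb T r)
    Orb-closed a b a∈O Tab = concept⁺ (relation⁺ λ X X-base@(_ , X-closed) →
      X-closed a b (relation⁻ (concept⁻ a∈O) X X-base) Tab)

    Orb-induction : (φ : Fm (obj ∷ Γ)) (ρ : Env M Γ) → Sat M φ (r ∷ₑ ρ) →
      (∀ a b → Sat M φ (a ∷ₑ ρ) → T ⟪ a , b ⟫ → Sat M φ (b ∷ₑ ρ)) →
      ∀ y → y ∈ Orb T r → Sat M φ (y ∷ₑ ρ)
    Orb-induction φ ρ base step y y∈O =
      concept⁻ (relation⁻ (concept⁻ y∈O) (concept φ ρ)
        (concept⁺ base , λ a b a∈X Tab → concept⁺ (step a b (concept⁻ a∈X) Tab)))

    Orb-inversion : ∀ y → y ∈ Orb T r → y ≡ r ⊎ Σ D λ a → a ∈ Orb T r × T ⟪ a , y ⟫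
    Orb-inversion = Orb-induction ((x0 ≐ᵛ x1) ∨̇ ∃̇ obj (x0 ∈̇ x4 ∧̇ x3 ⟨ x0 , x1 ⟩̇))
      (r ∷ₑ T ∷ₑ Orb T r ∷ₑ []ₑ) (inj₁ refl) λ a b a-inverted Tab → inj₂ (a , a∈O a a-inverted , Tab)
      where
      a∈O : ∀ a → a ≡ r ⊎ Σ D (λ c → c ∈ Orb T r × T ⟪ c , a ⟫) → a ∈ Orb T r
      a∈O a (inj₁ refl) = Orb-root
      a∈O a (inj₂ (c , c∈O , Tca)) = Orb-closed c a c∈O Tca

    Orb-DInfinite : IsInjection T → (∀ a → ¬ T ⟪ a , r ⟫) → DInfinite (Orb T r)
    Orb-DInfinite T-injection r∉range O-finite
      with O-finite T (IsInjection⇒IsInjectionOn T-injection Orb-closed) r Orb-root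
    ... | a , _ , Tar = r∉range a Tar

  Orb-disjoint : ∀ {T r r′} → Injective T → (∀ a → ¬ T ⟪ a , r ⟫) → (∀ a → ¬ T ⟪ a , r′ ⟫) →
    r ≢ r′ → ∀ y → y ∈ Orb T r → ¬ y ∈ Orb T r′
  Orb-disjoint {T} {r} {r′} T-injective r∉range r′∉range r≢r′ =
    Orb-induction (¬̇ x0 ∈̇ x1) (Orb T r′ ∷ₑ []ₑ) r∉O′ b∉O′
    where
    r∉O′ : ¬ r ∈ Orb T r′
    r∉O′ r∈O′ with Orb-inversion r r∈O′
    ... | inj₁ r≡r′ = r≢r′ r≡r′
    ... | inj₂ (a , _ , Tar) = r∉range a Tar
    b∉O′ : ∀ a b → ¬ a ∈ Orb T r′ → T ⟪ a , b ⟫ → ¬ b ∈ Orb T r′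
    b∉O′ a b a∉O′ Tab b∈O′ with Orb-inversion b b∈O′
    ... | inj₁ refl = r′∉range a Tab
    ... | inj₂ (c , c∈O′ , Tcb) with T-injective c a b Tcb Tab
    ... | refl = a∉O′ c∈O′

  -- {(Fⁿ r, Gⁿ s) : n ∈ ℕ}, as the least relation containing (r, s) and closed under F × G.
  Lockstep : Rel 1 → Rel 1 → D → D → Rel 1
  Lockstep F G r s = relation
    (∀̇ (rel 1) ((x0 ⟨ x3 , x4 ⟩̇ ∧̇ ∀̇ obj (∀̇ obj (∀̇ obj (∀̇ obj
      (x4 ⟨ x3 , x2 ⟩̇ ⇒ (x9 ⟨ x3 , x1 ⟩̇ ⇒ (x10 ⟨ x2 , x0 ⟩̇ ⇒ x4 ⟨ x1 , x0 ⟩̇)))))))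
      ⇒ x0 ⟨ x1 , x2 ⟩̇))
    (r ∷ₑ s ∷ₑ F ∷ₑ G ∷ₑ []ₑ)

  module _ {F G : Rel 1} {r s : D} where

    Lockstep-root : Lockstep F G r s ⟪ r , s ⟫
    Lockstep-root = relation⁺ λ X (base , _) → base

    Lockstep-step : ∀ a b c d → Lockstep F G r s ⟪ a , b ⟫ → F ⟪ a , c ⟫ → G ⟪ b , d ⟫ →
      Lockstep F G r s ⟪ c , d ⟫
    Lockstep-step a b c d Lab Fac Gbd = relation⁺ λ X X-base@(_ , X-closed) →
      X-closed a b c d (relation⁻ Lab X X-base) Fac Gbd

    Lockstep-induction : (φ : Fm (obj ∷ obj ∷ Γ)) (ρ : Env M Γ) → Sat M φ (r ∷ₑ s ∷ₑ ρ) →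
      (∀ a b c d → Sat M φ (a ∷ₑ b ∷ₑ ρ) → F ⟪ a , c ⟫ → G ⟪ b , d ⟫ → Sat M φ (c ∷ₑ d ∷ₑ ρ)) →
      ∀ n m → Lockstep F G r s ⟪ n , m ⟫ → Sat M φ (n ∷ₑ m ∷ₑ ρ)
    Lockstep-induction φ ρ base step n m Lnm =
      relation⁻ (relation⁻ Lnm (relation φ ρ)
        (relation⁺ base , λ a b c d φab Fac Gbd → relation⁺ (step a b c d (relation⁻ φab) Fac Gbd)))

    Lockstep-inversion : ∀ n m → Lockstep F G r s ⟪ n , m ⟫ →
      (n ≡ r × m ≡ s) ⊎ Σ D λ a → Σ D λ b → Lockstep F G r s ⟪ a , b ⟫ × F ⟪ a , n ⟫ × G ⟪ b , m ⟫
    Lockstep-inversion n m Lnm = proj₂ (Lockstep-induction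
      (x2 ⟨ x0 , x1 ⟩̇ ∧̇ ((x0 ≐ᵛ x3 ∧̇ x1 ≐ᵛ x4)
                        ∨̇ ∃̇ obj (∃̇ obj (x4 ⟨ x1 , x0 ⟩̇ ∧̇ (x7 ⟨ x1 , x2 ⟩̇ ∧̇ x8 ⟨ x0 , x3 ⟩̇)))))
      (Lockstep F G r s ∷ₑ r ∷ₑ s ∷ₑ F ∷ₑ G ∷ₑ []ₑ)
      (Lockstep-root , inj₁ (refl , refl))
      (λ a b c d (Lab , _) Fac Gbd →
        Lockstep-step a b c d Lab Fac Gbd , inj₂ (a , b , Lab , Fac , Gbd))
      n m Lnm)

    Lockstep-range : ∀ n m → Lockstep F G r s ⟪ n , m ⟫ → m ∈ Orb G s
    Lockstep-range = Lockstep-induction (x1 ∈̇ x2) (Orb G s ∷ₑ []ₑ)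
      Orb-root λ a b c d b∈O _ Gbd → Orb-closed b d b∈O Gbd

    Lockstep-dom-closed : Total G → Closed F (dom (Lockstep F G r s))
    Lockstep-dom-closed G-total a c a∈dom Fac with concept⁻ a∈dom
    ... | b , Lab = let (d , Gbd) = G-total b in concept⁺ (d , Lockstep-step a b c d Lab Fac Gbd)

    Lockstep-functional : Injective F → Functional G → (∀ a → ¬ F ⟪ a , r ⟫) →
      Functional (Lockstep F G r s)
    Lockstep-functional F-injective G-functional r∉range n m m′ Lnm Lnm′ =
      sym (Lockstep-induction (∀̇ obj (x3 ⟨ x1 , x0 ⟩̇ ⇒ x0 ≐ᵛ x2)) (Lockstep F G r s ∷ₑ []ₑ)
             base step n m Lnm m′ Lnm′)
      where
      base : ∀ m′ → Lockstep F G r s ⟪ r , m′ ⟫ → m′ ≡ s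
      base m′ Lrm′ with Lockstep-inversion r m′ Lrm′
      ... | inj₁ (_ , m′≡s) = m′≡s
      ... | inj₂ (a , _ , _ , Far , _) = ⊥-elim (r∉range a Far)
      step : ∀ a b c d → (∀ b′ → Lockstep F G r s ⟪ a , b′ ⟫ → b′ ≡ b) → F ⟪ a , c ⟫ → G ⟪ b , d ⟫ →
        ∀ d′ → Lockstep F G r s ⟪ c , d′ ⟫ → d′ ≡ d
      step a b c d a↦b Fac Gbd d′ Lcd′ with Lockstep-inversion c d′ Lcd′
      ... | inj₁ (refl , _) = ⊥-elim (r∉range a Fac)
      ... | inj₂ (a′ , b′ , La′b′ , Fa′c , Gb′d′) with F-injective a′ a c Fa′c Fac
      ... | refl with a↦b b′ La′b′
      ... | refl = G-functional b d′ d Gb′d′ Gbd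

  Lockstep-converse : ∀ {F G r s} n m → Lockstep F G r s ⟪ n , m ⟫ → Lockstep G F s r ⟪ m , n ⟫
  Lockstep-converse {F} {G} {r} {s} = Lockstep-induction (x2 ⟨ x1 , x0 ⟩̇) (Lockstep G F s r ∷ₑ []ₑ)
    Lockstep-root λ a b c d Lba Fac Gbd → Lockstep-step b a d c Lba Gbd Fac

  Lockstep-injective : ∀ {F G r s} → Injective G → Functional F → (∀ b → ¬ G ⟪ b , s ⟫) →
    Injective (Lockstep F G r s)
  Lockstep-injective G-injective F-functional s∉range n n′ m Lnm Ln′m =
    Lockstep-functional G-injective F-functional s∉range m n n′
      (Lockstep-converse n m Lnm) (Lockstep-converse n′ m Ln′m)

  record CoinfiniteInjection : Set where
    field
      graph         : Rel 1
      injection     : IsInjection graph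
      gap           : Rel 0
      gap-DInfinite : DInfinite gap
      gap-∉-range   : ∀ a b → graph ⟪ a , b ⟫ → ¬ b ∈ gap

  module Doubling (F : Rel 1) (F-injection : IsInjection F)
    (y₀ : D) (y₀∉range : ∀ a → ¬ F ⟪ a , y₀ ⟫) where
    open IsInjection F-injection

    F² : Rel 1
    F² = F ∘ʳ F

    F²-injection : IsInjection F²
    F²-injection = ∘-injection F-injection F-injection

    y₁ : D
    y₁ = proj₁ (total y₀)

    Fy₀y₁ : F ⟪ y₀ , y₁ ⟫
    Fy₀y₁ = proj₂ (total y₀)

    y₀∉range-F² : ∀ a → ¬ F² ⟪ a , y₀ ⟫
    y₀∉range-F² a F²ay₀ = let (c , _ , Fcy₀) = relation⁻ F²ay₀ in y₀∉range c Fcy₀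

    y₁∉range-F² : ∀ a → ¬ F² ⟪ a , y₁ ⟫
    y₁∉range-F² a F²ay₁ with relation⁻ F²ay₁
    ... | c , Fac , Fcy₁ with injective c y₀ y₁ Fcy₁ Fy₀y₁
    ... | refl = y₀∉range a Fac

    Evens Odds : Rel 0
    Evens = Orb F² y₀
    Odds = Orb F² y₁

    Evens-disjoint-Odds : ∀ y → y ∈ Evens → ¬ y ∈ Odds
    Evens-disjoint-Odds = Orb-disjoint (IsInjection.injective F²-injection) y₀∉range-F² y₁∉range-F²
      λ y₀≡y₁ → y₀∉range y₀ (subst (λ y → F ⟪ y₀ , y ⟫) (sym y₀≡y₁) Fy₀y₁)

    double : Rel 1
    double = Lockstep F F² y₀ y₀

    Dom : Rel 0
    Dom = dom double

    Dom-closed : Closed F Dom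
    Dom-closed = Lockstep-dom-closed (IsInjection.total F²-injection)

    y₀∈Dom : y₀ ∈ Dom
    y₀∈Dom = concept⁺ (y₀ , Lockstep-root)

    F²-orbit⊆Dom : ∀ {r} → r ∈ Dom → ∀ y → y ∈ Orb F² r → y ∈ Dom
    F²-orbit⊆Dom r∈Dom = Orb-induction (x0 ∈̇ x1) (Dom ∷ₑ []ₑ) r∈Dom λ a b a∈Dom F²ab →
      let (c , Fac , Fcb) = relation⁻ F²ab in Dom-closed c b (Dom-closed a c a∈Dom Fac) Fcb

    double-on-Dom : IsInjectionOn M double (_∈ Dom)
    double-on-Dom = total′
                  , (λ n m m′ _ → Lockstep-functional injective F².functional y₀∉range n m m′)
                  , (λ n n′ m _ _ → Lockstep-injective F².injective functional y₀∉range-F² n n′ m)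
      where
      module F² = IsInjection F²-injection
      total′ : ∀ n → n ∈ Dom → Σ D λ m → m ∈ Dom × double ⟪ n , m ⟫
      total′ n n∈Dom = let (m , Dnm) = concept⁻ n∈Dom in
        m , F²-orbit⊆Dom y₀∈Dom m (Lockstep-range n m Dnm) , Dnm

    H : Rel 1
    H = patch Dom double

    H-∉-Odds : ∀ a b → H ⟪ a , b ⟫ → ¬ b ∈ Odds
    H-∉-Odds a b Hab b∈Odds with relation⁻ Hab
    ... | inj₁ (_ , Dab) = Evens-disjoint-Odds b (Lockstep-range a b Dab) b∈Odds
    ... | inj₂ (a∉Dom , refl) = a∉Dom (F²-orbit⊆Dom (Dom-closed y₀ y₁ y₀∈Dom Fy₀y₁) b b∈Odds)

    coinfiniteInjection : CoinfiniteInjection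
    coinfiniteInjection = record
      { graph         = H
      ; injection     = patch-injection double-on-Dom
      ; gap           = Odds
      ; gap-DInfinite = Orb-DInfinite F²-injection y₁∉range-F²
      ; gap-∉-range   = H-∉-Odds
      }

  ¬CoinfiniteInjection⇒DFinite-V : ¬ CoinfiniteInjection → DFinite M (V M)
  ¬CoinfiniteInjection⇒DFinite-V ¬ci F F-injection y _ with lem (Σ D λ x → F ⟪ x , y ⟫)
  ... | inj₁ (x , Fxy) = x , refl , Fxy
  ... | inj₂ y∉range = ⊥-elim (¬ci (Doubling.coinfiniteInjection F
          (IsInjectionOn-V⇒IsInjection F-injection) y λ a Fay → y∉range (a , Fay)))

module Diagonal (lem : LEM) (M : Structure) (model : ModelOfA[E] M) where
  open Structure M
  open Definable lem M (proj₁ (proj₂ model))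

  ∂≡⇒E : ∀ {X Y} → del X ≡ del Y → E M X Y
  ∂≡⇒E = proj₁ (proj₁ model _ _)

  E⇒∂≡ : ∀ {X Y} → E M X Y → del X ≡ del Y
  E⇒∂≡ = proj₂ (proj₁ model _ _)

  IsAbstract : D → Set
  IsAbstract y = Σ (Rel 0) λ X → del X ≡ y

  Abstracts : Rel 0
  Abstracts = concept (∃̇ (rel 0) (∂ x0 ≐ var x1)) []ₑ

  representatives : Σ (Rel 1) λ R → ∀ y → IsAbstract y → del (section R y) ≡ y
  representatives with proj₁ (proj₂ (proj₂ model)) 1 0 φ []ₑ representative
    where
    φ : Fm (rel 0 ∷ obj ∷ [])
    φ = ∃̇ (rel 0) (∂ x0 ≐ var x2) ⇒ (∂ x0 ≐ var x1)

    representative : (w : Vec D 1) → Σ (Rel 0) λ X → Sat M φ (X ∷ₑ extVec M w []ₑ)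
    representative (y ∷ []) with lem (IsAbstract y)
    ... | inj₁ (X , ∂X≡y) = X , λ _ → ∂X≡y
    ... | inj₂ not-abstract = ∅ , λ y-abstract → ⊥-elim (not-abstract y-abstract)
  ... | R , sections = R , λ y y-abstract →
    let (S , S≈section , ∂S≡y) = sections (y ∷ []) in
    trans (cong del (sym (concept-ext λ w → (λ p → concept⁺ (proj₁ (S≈section (w ∷ [])) p))
                                          , (λ p → proj₂ (S≈section (w ∷ [])) (concept⁻ p)))))
          (∂S≡y y-abstract)

  R : Rel 1
  R = proj₁ representatives

  ∂-section-R : ∀ {y} → IsAbstract y → del (section R y) ≡ y
  ∂-section-R = proj₂ representatives _

  section-R-injective : ∀ {y y′} → IsAbstract y → IsAbstract y′ →
    E M (section R y) (section R y′) → y ≡ y′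
  section-R-injective y-abstract y′-abstract E-sections =
    trans (sym (∂-section-R y-abstract)) (trans (E⇒∂≡ E-sections) (∂-section-R y′-abstract))

  module _ (ci : CoinfiniteInjection) where
    open CoinfiniteInjection ci renaming (graph to H)

    -- Img A ⟪ y , w ⟫ says w ∈ H[R[y]] ∪ A.
    Img : Rel 0 → Rel 1
    Img A = relation (∃̇ obj (x3 ⟨ x1 , x0 ⟩̇ ∧̇ x4 ⟨ x0 , x2 ⟩̇) ∨̇ x1 ∈̇ x4) (R ∷ₑ H ∷ₑ A ∷ₑ []ₑ)

    img : Rel 0 → D → D
    img A y = del (section (Img A) y)

    Avoids : Rel 0 → Set
    Avoids A = ∀ a b → H ⟪ a , b ⟫ → ¬ b ∈ A

    image-∈ : ∀ {A y a b} → R ⟪ y , a ⟫ → H ⟪ a , b ⟫ → b ∈ section (Img A) y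
    image-∈ Rya Hab = concept⁺ (relation⁺ (inj₁ (_ , Rya , Hab)))

    image-∉ : ∀ {A y a b} → Avoids A → ¬ R ⟪ y , a ⟫ → H ⟪ a , b ⟫ → ¬ b ∈ section (Img A) y
    image-∉ A-avoided ¬Rya Hab b∈image with relation⁻ (concept⁻ b∈image)
    ... | inj₂ b∈A = A-avoided _ _ Hab b∈A
    ... | inj₁ (u , Ryu , Hub) with IsInjection.injective injection u _ _ Hub Hab
    ... | refl = ¬Rya Ryu

    image-SymDiff : ∀ {A y y′ a b} → Avoids A → SymDiff M (section R y) (section R y′) a →
      H ⟪ a , b ⟫ → SymDiff M (section (Img A) y) (section (Img A) y′) b
    image-SymDiff A-avoided (inj₁ (a∈ , a∉)) Hab =
      inj₁ (image-∈ (concept⁻ a∈) Hab , image-∉ A-avoided (λ Ra → a∉ (concept⁺ Ra)) Hab)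
    image-SymDiff A-avoided (inj₂ (a∈ , a∉)) Hab =
      inj₂ (image-∈ (concept⁻ a∈) Hab , image-∉ A-avoided (λ Ra → a∉ (concept⁺ Ra)) Hab)

    img-injective : ∀ {A y y′} → Avoids A → IsAbstract y → IsAbstract y′ →
      img A y ≡ img A y′ → y ≡ y′
    img-injective A-avoided y-abstract y′-abstract img≡ =
      section-R-injective y-abstract y′-abstract
        (E-pullback injection (λ _ _ → image-SymDiff A-avoided) (∂≡⇒E img≡))

    ∅-avoided : Avoids ∅
    ∅-avoided _ _ _ = concept⁻

    successor : Rel 1
    successor = ∂Graph (Img ∅)

    successor-on-Abstracts : IsInjectionOn M successor (_∈ Abstracts)
    successor-on-Abstracts =
        (λ y _ → img ∅ y , concept⁺ (section (Img ∅) y , refl) , ∂Graph⁺ refl)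
      , (λ y t t′ _ p q → trans (∂Graph⁻ p) (sym (∂Graph⁻ q)))
      , (λ y y′ t y-abstract y′-abstract p q →
           img-injective ∅-avoided (concept⁻ y-abstract) (concept⁻ y′-abstract)
             (trans (sym (∂Graph⁻ p)) (∂Graph⁻ q)))

    T : Rel 1
    T = patch Abstracts successor

    T-injection : IsInjection T
    T-injection = patch-injection successor-on-Abstracts

    k : D → D
    k = img gap

    k-∉-range : ∀ x a → ¬ T ⟪ a , k x ⟫
    k-∉-range x a Tak with relation⁻ Tak
    ... | inj₂ (a∉Abstracts , k≡a) = a∉Abstracts (concept⁺ (section (Img gap) x , k≡a))
    ... | inj₁ (_ , successor-a) =
      DInfinite-subset gap-DInfinite gap⊆SymDiff (∂≡⇒E (sym (∂Graph⁻ successor-a)))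
      where
      gap⊆SymDiff : ∀ w → w ∈ gap → SymDiff M (section (Img ∅) a) (section (Img gap) x) w
      gap⊆SymDiff w w∈gap = inj₂ (concept⁺ (relation⁺ (inj₂ w∈gap)) , w∉image)
        where
        w∉image : ¬ w ∈ section (Img ∅) a
        w∉image w∈image with relation⁻ (concept⁻ w∈image)
        ... | inj₁ (u , _ , Huw) = gap-∉-range u w Huw w∈gap
        ... | inj₂ w∈∅ = concept⁻ w∈∅

    Orb-k-disjoint : ∀ {x x′} → IsAbstract x → IsAbstract x′ → x ≢ x′ →
      ∀ y → y ∈ Orb T (k x) → ¬ y ∈ Orb T (k x′)
    Orb-k-disjoint {x} {x′} x-abstract x′-abstract x≢x′ =
      Orb-disjoint (IsInjection.injective T-injection) (k-∉-range x) (k-∉-range x′)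
        λ k≡ → x≢x′ (img-injective gap-∉-range x-abstract x′-abstract k≡)

    Diag : Rel 0
    Diag = concept (∃̇ obj (x0 ∈̇ x4 ∧̇ (¬̇ x2 ⟨ x0 , x1 ⟩̇ ∧̇ ∃̇ obj (x6 ⟨ x1 , x0 ⟩̇ ∧̇ x4 ⟨ x0 , x2 ⟩̇))))
                   (R ∷ₑ Orbits T ∷ₑ Abstracts ∷ₑ ∂Graph (Img gap) ∷ₑ []ₑ)

    Diag⁺ : ∀ {x y} → IsAbstract x → y ∈ Orb T (k x) → ¬ R ⟪ x , y ⟫ → y ∈ Diag
    Diag⁺ {x} x-abstract y∈orbit ¬Rxy =
      concept⁺ (x , concept⁺ x-abstract , ¬Rxy , k x , ∂Graph⁺ refl , concept⁻ y∈orbit)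

    Diag⁻ : ∀ {y} → y ∈ Diag → Σ D λ x → IsAbstract x × y ∈ Orb T (k x) × ¬ R ⟪ x , y ⟫
    Diag⁻ y∈Diag with concept⁻ y∈Diag
    ... | x , x-abstract , ¬Rxy , t , Kxt , Otx with ∂Graph⁻ Kxt
    ... | refl = x , concept⁻ x-abstract , concept⁺ Otx , ¬Rxy

    ¬CoinfiniteInjection : ⊥
    ¬CoinfiniteInjection =
      DInfinite-subset (Orb-DInfinite T-injection (k-∉-range z)) orbit⊆SymDiff
        (∂≡⇒E (sym (∂-section-R z-abstract)))
      where
      z : D
      z = del Diag
      z-abstract : IsAbstract z
      z-abstract = Diag , refl
      orbit⊆SymDiff : ∀ y → y ∈ Orb T (k z) → SymDiff M Diag (section R z) y
      orbit⊆SymDiff y y∈orbit with lem (R ⟪ z , y ⟫)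
      ... | inj₂ ¬Rzy = inj₁ (Diag⁺ z-abstract y∈orbit ¬Rzy , λ Rzy → ¬Rzy (concept⁻ Rzy))
      ... | inj₁ Rzy = inj₂ (concept⁺ Rzy , y∉Diag)
        where
        y∉Diag : ¬ y ∈ Diag
        y∉Diag y∈Diag with Diag⁻ y∈Diag
        ... | x , x-abstract , y∈orbit-x , ¬Rxy with lem (x ≡ z)
        ... | inj₁ refl = ¬Rxy Rzy
        ... | inj₂ x≢z = Orb-k-disjoint x-abstract z-abstract x≢z y y∈orbit-x y∈orbit

proposition15 : LEM → (M : Structure) → ModelOfA[E] M → DFinite M (V M)
proposition15 lem M model =
  ¬CoinfiniteInjection⇒DFinite-V (Diagonal.¬CoinfiniteInjection lem M model)
  where open Definable lem M (proj₁ (proj₂ model))
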